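{- Let $1\le p_1\le\cdots\le p_d\le n$ be integers, and let $G_0$ be the $d$-uniform $d$-partite hypergraph with vertex classes $V_1,\ldots,V_d$, each consisting of $n$ vertices labeled $1,\ldots,n$, with edges identified with tuples $(x_1,\ldots,x_d)\in[n]^d$, where $(x_1,\ldots,x_d)$ is not an edge of $G_0$ if and only if $x_{(i)}\ge p_i$ for every $1\le i\le d$. Let $\overline{G_0}$ be its complement, i.e., the $d$-partite hypergraph on the same classes whose edges are exactly the tuples in $[n]^d$ that are not edges of $G_0$. Then for every permutation $\pi:[d]\to[d]$, $\overline{G_0}$ contains a copy of $K^d_{n-p_1+1,\ldots,n-p_d+1}$ having exactly $n-p_{\pi(i)}+1$ vertices in the $i$-th vertex class $V_i$ for each $i$.
   Context: $x_{(i)}$ denotes the $i$-th smallest entry of $x$ when sorted with repetitions. $K^d_{m_1,\ldots,m_d}$ is the complete $d$-uniform $d$-partite hypergraph with classes of sizes $m_1,\ldots,m_d$; a copy with $m_{\pi(i)}$ vertices in $V_i$ means sets $S_i\subseteq V_i$ with $|S_i|=n-p_{\pi(i)}+1$ such that every tuple with $i$-th vertex in $S_i$ for all $i$ is an edge. -}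

module Defs where

open import Data.Nat using (ℕ; zero; suc; _≤_; _≥_; _≤ᵇ_; _+_; _∸_)
open import Data.Bool using (if_then_else_)
open import Data.Fin using (Fin; toℕ)
open import Data.Fin.Subset using (Subset; _∈_; ∣_∣)
open import Data.Fin.Permutation using (Permutation′; _⟨$⟩ʳ_)
open import Data.Vec using (Vec; []; _∷_; lookup; tabulate)
open import Relation.Nullary using (¬_)
open import Data.Product using (Σ; _×_)
open import Relation.Binary.PropositionalEquality using (_≡_)

insert : {k : ℕ} → ℕ → Vec ℕ k → Vec ℕ (suc k)
insert a [] = a ∷ []
insert a (b ∷ bs) = if a ≤ᵇ b then a ∷ b ∷ bs else b ∷ insert a bs

sortVec : {k : ℕ} → Vec ℕ k → Vec ℕ k
sortVec [] = []
sortVec (a ∷ as) = insert a (sortVec as)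

-- Vertices of each class are Fin n; vertex v carries the label toℕ v + 1 ∈ [n].
label : {n : ℕ} → Fin n → ℕ
label v = suc (toℕ v)

Tuple : ℕ → ℕ → Set
Tuple d n = Fin d → Fin n

-- x_(i): the i-th smallest label of x (i ∈ Fin d, 0-based index of the 1-based i).
orderStat : {d n : ℕ} → Tuple d n → Fin d → ℕ
orderStat x i = lookup (sortVec (tabulate (λ j → label (x j)))) i

Monotone : {d : ℕ} → (Fin d → ℕ) → Set
Monotone {d} p = ∀ (i j : Fin d) → toℕ i ≤ toℕ j → p i ≤ p j

EdgeG0 : {d n : ℕ} → (Fin d → ℕ) → Tuple d n → Set
EdgeG0 p x = ¬ (∀ i → orderStat x i ≥ p i)

EdgeCompl : {d n : ℕ} → (Fin d → ℕ) → Tuple d n → Set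
EdgeCompl p x = ¬ EdgeG0 p x

ContainsCopy : {d : ℕ} (n : ℕ) → (Fin d → ℕ) → Permutation′ d → Set
ContainsCopy {d} n p π =
  Σ (Fin d → Subset n) λ S →
    (∀ i → ∣ S i ∣ ≡ (n ∸ p (π ⟨$⟩ʳ i) + 1)) ×
    (∀ (x : Tuple d n) → (∀ i → x i ∈ S i) → EdgeCompl p x)

-- Take S_i to be the vertices with label at least p_{π(i)}, so that |S_i| = n − p_{π(i)} + 1.
-- If x_i ∈ S_i for all i but x_(k) < p_k, then at least k labels of x lie below p_k.  Yet
-- x_i < p_k forces p_{π(i)} < p_k, hence π(i) < k by monotonicity, and only k − 1 indices i
-- satisfy π(i) < k.
module Submission where

open import Defs
open import Data.Nat using (ℕ; _≤_)
open import Data.Fin using (Fin)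
open import Data.Fin.Permutation using (Permutation′)

open import Data.Nat using (zero; suc; _+_; _∸_; _<_; _≥_; _≤ᵇ_; _<ᵇ_; _⊓_; z≤n; s≤s)
open import Data.Nat.Properties
open import Data.Bool using (true; false; T; if_then_else_)
open import Data.Unit using (tt)
open import Data.Fin using (toℕ)
open import Data.Fin.Permutation using (_⟨$⟩ʳ_)
open import Data.Fin.Subset using (Subset; _∈_; ∣_∣)
open import Data.Vec using (Vec; []; _∷_; lookup; tabulate)
open import Data.Vec.Properties using ([]=⇒lookup; lookup∘tabulate)
open import Data.Vec.Relation.Unary.All as All using (All; []; _∷_)
open import Data.Vec.Relation.Unary.All.Properties using (lookup⁺)
open import Data.Vec.Relation.Unary.AllPairs using (AllPairs; []; _∷_)
open import Data.Product using (_,_)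
open import Relation.Nullary using (contradiction)
open import Relation.Nullary.Reflects using (ofʸ; ofⁿ)
open import Relation.Binary.PropositionalEquality
open import Algebra.Properties.CommutativeSemigroup +-commutativeSemigroup using (x∙yz≈y∙xz)
open import Algebra.Properties.CommutativeMonoid.Sum +-0-commutativeMonoid using (sum; sum-permute)

below : ℕ → ℕ → ℕ
below c a = if a <ᵇ c then 1 else 0

below-< : ∀ {a c} → a < c → below c a ≡ 1
below-< {a} {c} a<c with a <ᵇ c | <ᵇ-reflects-< a c
... | true  | _       = refl
... | false | ofⁿ a≮c = contradiction a<c a≮c

below-mono : ∀ {a b c e} → (a < c → b < e) → below c a ≤ below e b
below-mono {a} {b} {c} {e} imp with a <ᵇ c | <ᵇ-reflects-< a c
... | false | _       = z≤n
... | true  | ofʸ a<c with b <ᵇ e | <ᵇ-reflects-< b e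
...   | true  | _       = ≤-refl
...   | false | ofⁿ b≮e = contradiction (imp a<c) b≮e

countBelow : ∀ {k} → ℕ → Vec ℕ k → ℕ
countBelow c []       = 0
countBelow c (a ∷ as) = below c a + countBelow c as

countBelow-insert : ∀ {k} c a (bs : Vec ℕ k) → countBelow c (insert a bs) ≡ countBelow c (a ∷ bs)
countBelow-insert c a []       = refl
countBelow-insert c a (b ∷ bs) with a ≤ᵇ b
... | true  = refl
... | false = trans (cong (below c b +_) (countBelow-insert c a bs)) (x∙yz≈y∙xz (below c b) (below c a) _)

countBelow-sortVec : ∀ {k} c (v : Vec ℕ k) → countBelow c (sortVec v) ≡ countBelow c v
countBelow-sortVec c []       = refl
countBelow-sortVec c (a ∷ as) =
  trans (countBelow-insert c a (sortVec as)) (cong (below c a +_) (countBelow-sortVec c as))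

countBelow-tabulate : ∀ {d} c (f : Fin d → ℕ) → countBelow c (tabulate f) ≡ sum (λ i → below c (f i))
countBelow-tabulate {zero}  c f = refl
countBelow-tabulate {suc d} c f = cong (below c (f Fin.zero) +_) (countBelow-tabulate c (λ i → f (Fin.suc i)))

Sorted : ∀ {k} → Vec ℕ k → Set
Sorted = AllPairs _≤_

insert-lowerBound : ∀ {k a b} (bs : Vec ℕ k) → b ≤ a → All (b ≤_) bs → All (b ≤_) (insert a bs)
insert-lowerBound             []       b≤a []          = b≤a ∷ []
insert-lowerBound {a = a} (c ∷ cs) b≤a (b≤c ∷ b≤cs) with a ≤ᵇ c
... | true  = b≤a ∷ b≤c ∷ b≤cs
... | false = b≤c ∷ insert-lowerBound cs b≤a b≤cs

insert-sorted : ∀ {k} a (bs : Vec ℕ k) → Sorted bs → Sorted (insert a bs)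
insert-sorted a []       []            = [] ∷ []
insert-sorted a (b ∷ bs) (b≤bs ∷ sbs) with a ≤ᵇ b | ≤ᵇ-reflects-≤ a b
... | true  | ofʸ a≤b = (a≤b ∷ All.map (≤-trans a≤b) b≤bs) ∷ b≤bs ∷ sbs
... | false | ofⁿ a≰b = insert-lowerBound bs (≰⇒≥ a≰b) b≤bs ∷ insert-sorted a bs sbs

sortVec-sorted : ∀ {k} (v : Vec ℕ k) → Sorted (sortVec v)
sortVec-sorted []       = []
sortVec-sorted (a ∷ as) = insert-sorted a (sortVec as) (sortVec-sorted as)

sorted-lookup<⇒countBelow : ∀ {k} c (w : Vec ℕ k) → Sorted w → (i : Fin k) →
                            lookup w i < c → suc (toℕ i) ≤ countBelow c w
sorted-lookup<⇒countBelow c (a ∷ w) (_ ∷ _) Fin.zero a<c rewrite below-< a<c = s≤s z≤n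
sorted-lookup<⇒countBelow c (a ∷ w) (a≤w ∷ sw) (Fin.suc i) wᵢ<c
  rewrite below-< (≤-<-trans (lookup⁺ a≤w i) wᵢ<c) = s≤s (sorted-lookup<⇒countBelow c w sw i wᵢ<c)

countBelow≤⇒lookup-sortVec≥ : ∀ {k} c (v : Vec ℕ k) (i : Fin k) →
                              countBelow c v ≤ toℕ i → lookup (sortVec v) i ≥ c
countBelow≤⇒lookup-sortVec≥ c v i count≤i = ≮⇒≥ λ vᵢ<c → <⇒≱
  (begin-strict
    toℕ i                    <⟨ sorted-lookup<⇒countBelow c (sortVec v) (sortVec-sorted v) i vᵢ<c ⟩
    countBelow c (sortVec v) ≡⟨ countBelow-sortVec c v ⟩
    countBelow c v           ∎)
  count≤i
  where open ≤-Reasoning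

sum-mono-≤ : ∀ {d} (f g : Fin d → ℕ) → (∀ i → f i ≤ g i) → sum f ≤ sum g
sum-mono-≤ {zero}  f g f≤g = z≤n
sum-mono-≤ {suc d} f g f≤g =
  +-mono-≤ (f≤g Fin.zero) (sum-mono-≤ (λ i → f (Fin.suc i)) (λ i → g (Fin.suc i)) (λ i → f≤g (Fin.suc i)))

sum-below-toℕ : ∀ d m → sum {d} (λ i → below m (toℕ i)) ≡ m ⊓ d
sum-below-toℕ zero    zero    = refl
sum-below-toℕ zero    (suc m) = refl
sum-below-toℕ (suc d) zero    = sum-below-toℕ d zero
sum-below-toℕ (suc d) (suc m) = cong suc (sum-below-toℕ d m)

sum-below-permute : ∀ {d} m (π : Permutation′ d) → sum (λ i → below m (toℕ (π ⟨$⟩ʳ i))) ≤ m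
sum-below-permute {d} m π = begin
  sum (λ i → below m (toℕ (π ⟨$⟩ʳ i))) ≡⟨ sum-permute (λ i → below m (toℕ i)) π ⟨
  sum {d} (λ i → below m (toℕ i))      ≡⟨ sum-below-toℕ d m ⟩
  m ⊓ d                                ≤⟨ m⊓n≤m m d ⟩
  m                                    ∎
  where open ≤-Reasoning

Monotone⇒<-reflecting : ∀ {d} {p : Fin d → ℕ} → Monotone p → ∀ {i j} → p i < p j → toℕ i < toℕ j
Monotone⇒<-reflecting mono {i} {j} pᵢ<pⱼ = ≰⇒> λ j≤i → <⇒≱ pᵢ<pⱼ (mono j i j≤i)

atLeast : ∀ n → ℕ → Subset n
atLeast n c = tabulate (λ v → c ≤ᵇ label v)

∈-atLeast⇒≤ : ∀ {n c} (v : Fin n) → v ∈ atLeast n c → c ≤ label v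
∈-atLeast⇒≤ {c = c} v v∈ =
  ≤ᵇ⇒≤ c (label v) (subst T (trans (sym ([]=⇒lookup v∈)) (lookup∘tabulate _ v)) tt)

∣atLeast∣ : ∀ n c → ∣ atLeast n c ∣ ≡ n ∸ (c ∸ 1)
∣atLeast∣ zero    c             = sym (0∸n≡0 (c ∸ 1))
∣atLeast∣ (suc n) zero          = cong suc (∣atLeast∣ n zero)
∣atLeast∣ (suc n) (suc zero)    = cong suc (∣atLeast∣ n zero)
∣atLeast∣ (suc n) (suc (suc c)) = ∣atLeast∣ n (suc c)

∣atLeast∣≡∸+1 : ∀ {n c} → 1 ≤ c → c ≤ n → ∣ atLeast n c ∣ ≡ n ∸ c + 1
∣atLeast∣≡∸+1 {n} {suc c} _ c<n = trans (∣atLeast∣ n (suc c)) (trans (+-∸-assoc 1 c<n) (+-comm 1 (n ∸ suc c)))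

claim1 : (d n : ℕ) (p : Fin d → ℕ) →
    (∀ i → 1 ≤ p i) → Monotone p → (∀ i → p i ≤ n) →
    (π : Permutation′ d) → ContainsCopy n p π
claim1 d n p 1≤p mono p≤n π = S , (λ i → ∣atLeast∣≡∸+1 (1≤p (πʳ i)) (p≤n (πʳ i))) , isEdge
  where
  πʳ : Fin d → Fin d
  πʳ = π ⟨$⟩ʳ_

  S : Fin d → Subset n
  S i = atLeast n (p (πʳ i))

  fewBelow : ∀ (x : Tuple d n) → (∀ i → x i ∈ S i) → ∀ k →
             countBelow (p k) (tabulate (λ i → label (x i))) ≤ toℕ k
  fewBelow x x∈S k = begin
    countBelow (p k) (tabulate xˡ)         ≡⟨ countBelow-tabulate (p k) xˡ ⟩
    sum (λ i → below (p k) (xˡ i))         ≤⟨ sum-mono-≤ _ (λ i → below (p k) (p (πʳ i)))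
                                               (λ i → below-mono {c = p k} (≤-<-trans (∈-atLeast⇒≤ (x i) (x∈S i)))) ⟩
    sum (λ i → below (p k) (p (πʳ i)))     ≤⟨ sum-mono-≤ _ (λ i → below (toℕ k) (toℕ (πʳ i)))
                                               (λ i → below-mono (Monotone⇒<-reflecting mono)) ⟩
    sum (λ i → below (toℕ k) (toℕ (πʳ i))) ≤⟨ sum-below-permute (toℕ k) π ⟩
    toℕ k                                  ∎
    where
    open ≤-Reasoning
    xˡ : Fin d → ℕ
    xˡ i = label (x i)

  isEdge : ∀ (x : Tuple d n) → (∀ i → x i ∈ S i) → EdgeCompl p x
  isEdge x x∈S notAllLarge =
    notAllLarge (λ k → countBelow≤⇒lookup-sortVec≥ (p k) (tabulate (λ i → label (x i))) k (fewBelow x x∈S k))
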